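{- For every integer $n\ge1$, the linear map $\theta_n:\mathrm{Prim}_{Coass}(\mathcal{A})_n\otimes\mathbb{K}Y\to\mathrm{Prim}_{Codend}(\mathcal{A})_{n+1}$, $a\otimes Y\mapsto a\cdot Y$, is well defined and is an isomorphism of vector spaces, where $Y=|\vee|$.
   Context: A reduced tree is a planar rooted tree (root edge below the root, leaves as top edges) whose internal vertices have at least two children; $|$ is the one-leaf tree; $T_n$ = reduced trees with $n+1$ leaves; $\mathcal{A}_n=\mathbb{K}T_n$, $\mathcal{A}=\bigoplus_{n\ge0}\mathcal{A}_n$, $\mathcal{A}^+=\bigoplus_{n\ge1}\mathcal{A}_n$. With $x^{(0)}\vee\cdots\vee x^{(k)}$ the grafting of trees left to right on a new root, recursively $x\prec y=x^{(0)}\vee\cdots\vee x^{(k-1)}\vee(x^{(k)}*y)$, $x\cdot y=x^{(0)}\vee\cdots\vee x^{(k-1)}\vee(x^{(k)}*y^{(0)})\vee y^{(1)}\vee\cdots\vee y^{(l)}$, $x\succ y=(x*y^{(0)})\vee y^{(1)}\vee\cdots\vee y^{(l)}$ for $x=x^{(0)}\vee\cdots\vee x^{(k)}$, $y=y^{(0)}\vee\cdots\vee y^{(l)}$, $*=\prec+\cdot+\succ$, $|$ the unit. Admissible cuts: an internal edge joins two internal vertices; an admissible cut is a nonempty set $c$ of internal edges with at most one on each root-to-leaf path, or the empty cut, or the total cut; removing the edges of a nonempty non-total $c$ gives subtrees $G^c_1(t),\dots,G^c_m(t)$ (left to right; cut edges become root edges) and the root component $P^c(t)$ (cut edges become leaves),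 $G^c(t)=G^c_1(t)*\cdots*G^c_m(t)$; empty cut: $P^c=t,G^c=|$; total cut: $P^c=|,G^c=t$. For trees $t\ne|$: $\tilde\Delta(t)=\sum_cG^c(t)\otimes P^c(t)-t\otimes|-|\otimes t$ over all admissible cuts; $\tilde\Delta_\leftarrow(t)$ = the sum over admissible cuts with the right-most leaf of $t$ in some $G^c_i(t)$ (incl. total cut) minus $t\otimes|$; $\tilde\Delta_\rightarrow(t)$ = the sum over admissible cuts with the right-most leaf in $P^c(t)$ (incl. empty cut) minus $|\otimes t$. $\mathrm{Prim}_{Coass}(\mathcal{A})_n=\{x\in\mathcal{A}_n:\tilde\Delta(x)=0\}$, $\mathrm{Prim}_{Codend}(\mathcal{A})_n=\{x\in\mathcal{A}_n:\tilde\Delta_\leftarrow(x)=\tilde\Delta_\rightarrow(x)=0\}$, for $n\ge1$. -}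

module Defs where

open import Level using (Level; _⊔_) renaming (suc to lsuc)
open import Data.Nat using (ℕ; zero; suc) renaming (_+_ to _+ℕ_)
open import Data.Bool using (Bool; true; false; if_then_else_; not; _∧_)
open import Data.List using (List; []; _∷_; _++_; map; concatMap)
open import Data.List.Relation.Unary.All using (All)
open import Data.Product using (Σ; _×_; _,_)
open import Relation.Nullary using (¬_; Dec; yes; no)
open import Relation.Nullary.Decidable using (⌊_⌋)
open import Relation.Binary.PropositionalEquality using (_≡_; refl)
open import Algebra.Bundles using (CommutativeRing)

record Field (c ℓ : Level) : Set (lsuc (c ⊔ ℓ)) where
  field
    commutativeRing : CommutativeRing c ℓ
  open CommutativeRing commutativeRing public
  field
    1≉0     : ¬ (1# ≈ 0#)
    inverse : ∀ x → ¬ (x ≈ 0#) → Σ Carrier λ y → (x * y) ≈ 1#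

-- Planar rooted trees.  'leaf' is the one-leaf tree |, and
-- 'node (t₀ ∷ … ∷ tₖ ∷ [])' is the grafting t₀ ∨ ⋯ ∨ tₖ on a new root.

data Tree : Set where
  leaf : Tree
  node : List Tree → Tree

data Reduced : Tree → Set where
  leaf-red : Reduced leaf
  node-red : ∀ {t u ts} → All Reduced (t ∷ u ∷ ts) → Reduced (node (t ∷ u ∷ ts))

mutual
  leaves : Tree → ℕ
  leaves leaf      = 1
  leaves (node ts) = leavesL ts

  leavesL : List Tree → ℕ
  leavesL []       = 0
  leavesL (t ∷ ts) = leaves t +ℕ leavesL ts

InT : ℕ → Tree → Set
InT n t = Reduced t × leaves t ≡ suc n

Y : Tree
Y = node (leaf ∷ leaf ∷ [])

mutual
  _≟T_ : (s t : Tree) → Dec (s ≡ t)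
  leaf    ≟T leaf    = yes refl
  leaf    ≟T node _  = no λ ()
  node _  ≟T leaf    = no λ ()
  node xs ≟T node ys with xs ≟L ys
  ... | yes refl = yes refl
  ... | no ¬p    = no λ { refl → ¬p refl }

  _≟L_ : (xs ys : List Tree) → Dec (xs ≡ ys)
  []       ≟L []       = yes refl
  []       ≟L (_ ∷ _)  = no λ ()
  (_ ∷ _)  ≟L []       = no λ ()
  (x ∷ xs) ≟L (y ∷ ys) with x ≟T y | xs ≟L ys
  ... | yes refl | yes refl = yes refl
  ... | no ¬p    | _        = no λ { refl → ¬p refl }
  ... | yes _    | no ¬q    = no λ { refl → ¬q refl }

-- For a tree, an "option" is a choice of admissible cut
-- among its internal edges, recorded as
--   (G₁ ∷ … ∷ Gₘ ∷ [] , Pᶜ(t) , rightmost leaf lies in some Gᵢ?).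
-- The empty cut is the unique option with m = 0; the total cut is not listed.

Opt : Set
Opt = List Tree × Tree × Bool

mkNode : List Tree × List Tree × Bool → Opt
mkNode (gs , ps , b) = gs , node ps , b

single : Opt → List Tree × List Tree × Bool
single (g , p , b) = g , p ∷ [] , b

-- combine the options of a child with those of the children to its right
-- (the rightmost-leaf flag comes from the right part)
combine : List Opt → List (List Tree × List Tree × Bool) → List (List Tree × List Tree × Bool)
combine os rs = concatMap (λ { (g , p , _) → map (λ { (gs , ps , b) → g ++ gs , p ∷ ps , b }) rs }) os

mutual
  cutsT : Tree → List Opt
  cutsT leaf      = (([] , leaf , false)) ∷ []
  cutsT (node ts) = map mkNode (cutsL ts)

  cutsL : List Tree → List (List Tree × List Tree × Bool)
  cutsL []       = ([] , [] , false) ∷ []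
  cutsL (t ∷ []) = map single (childOpts t)
  cutsL (t ∷ ts@(_ ∷ _)) = combine (childOpts t) (cutsL ts)

  -- options for the edge from a vertex to its child t (plus everything above it):
  -- the edge is internal iff t is not a leaf; then it may be cut (t goes to G,
  -- the edge becomes a leaf of Pᶜ) or not cut.
  childOpts : Tree → List Opt
  childOpts leaf          = (([] , leaf , false)) ∷ []
  childOpts (node ts)     = ((node ts ∷ []) , leaf , true) ∷ cutsT (node ts)

isCons : ∀ {A : Set} → List A → Bool
isCons []      = false
isCons (_ ∷ _) = true

module _ {c ℓ : Level} (F : Field c ℓ) where
  open Field F

  Lin : Set c
  Lin = List (Carrier × Tree)

  Lin2 : Set c
  Lin2 = List (Carrier × Tree × Tree)

  coeff : Tree → Lin → Carrier
  coeff t []            = 0#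
  coeff t ((a , s) ∷ x) = if ⌊ s ≟T t ⌋ then a + coeff t x else coeff t x

  coeff2 : Tree → Tree → Lin2 → Carrier
  coeff2 s t []                 = 0#
  coeff2 s t ((a , u , v) ∷ x) =
    if ⌊ u ≟T s ⌋ ∧ ⌊ v ≟T t ⌋ then a + coeff2 s t x else coeff2 s t x

  _≈L_ : Lin → Lin → Set ℓ
  x ≈L y = ∀ t → coeff t x ≈ coeff t y

  IsZero2 : Lin2 → Set ℓ
  IsZero2 x = ∀ s t → coeff2 s t x ≈ 0#

  InA : ℕ → Lin → Set ℓ
  InA n x = ∀ t → ¬ InT n t → coeff t x ≈ 0#

  scale : Carrier → Lin → Lin
  scale a = map (λ { (b , t) → a * b , t })

  scale2 : Carrier → Lin2 → Lin2
  scale2 a = map (λ { (b , u) → a * b , u })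

  -- the product * on trees (| is the unit), with ≺, · and ≻ built in.
  mutual
    _*T_ : Tree → Tree → Lin
    leaf *T y = (1# , y) ∷ []
    x@(node _) *T leaf = (1# , x) ∷ []
    x@(node xs) *T y@(node []) = (1# , x) ∷ []     -- not a reduced tree; never used
    x@(node xs) *T y@(node (y₀ ∷ ys)) =
         map (λ { (a , l) → a , node l }) (lastStar xs y)          -- x ≺ y
      ++ map (λ { (a , l) → a , node (l ++ ys) }) (lastStar xs y₀) -- x · y
      ++ map (λ { (a , t) → a , node (t ∷ ys) }) (x *T y₀)         -- x ≻ y

    lastStar : List Tree → Tree → List (Carrier × List Tree)
    lastStar [] z = []
    lastStar (x ∷ []) z = map (λ { (a , t) → a , t ∷ [] }) (x *T z)
    lastStar (x ∷ xs@(_ ∷ _)) z = map (λ { (a , l) → a , x ∷ l }) (lastStar xs z)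

  _·T_ : Tree → Tree → Lin
  leaf ·T y = []
  node xs ·T leaf = []
  node xs ·T node [] = []
  node xs ·T node (y₀ ∷ ys) = map (λ { (a , l) → a , node (l ++ ys) }) (lastStar xs y₀)

  _*L_ : Lin → Lin → Lin
  x *L y = concatMap (λ { (a , s) → concatMap (λ { (b , t) → scale (a * b) (s *T t) }) y }) x

  _·L_ : Lin → Lin → Lin
  x ·L y = concatMap (λ { (a , s) → concatMap (λ { (b , t) → scale (a * b) (s ·T t) }) y }) x

  prodG : List Tree → Lin
  prodG []       = (1# , leaf) ∷ []
  prodG (g ∷ gs) = ((1# , g) ∷ []) *L prodG gs

  deltaSel : (Bool → Bool) → Tree → Lin2
  deltaSel sel t =
    concatMap (λ { (gs , p , b) →
                   if isCons gs ∧ sel b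
                   then map (λ { (a , u) → a , u , p }) (prodG gs)
                   else [] })
              (cutsT t)

  deltaSelL : (Bool → Bool) → Lin → Lin2
  deltaSelL sel x = concatMap (λ { (a , t) → scale2 a (deltaSel sel t) }) x

  Δ̃ : Lin → Lin2
  Δ̃ = deltaSelL (λ _ → true)

  Δ̃← : Lin → Lin2
  Δ̃← = deltaSelL (λ b → b)

  Δ̃→ : Lin → Lin2
  Δ̃→ = deltaSelL not

  PrimCoass : ℕ → Lin → Set ℓ
  PrimCoass n x = InA n x × IsZero2 (Δ̃ x)

  PrimCodend : ℕ → Lin → Set ℓ
  PrimCodend n x = InA n x × IsZero2 (Δ̃← x) × IsZero2 (Δ̃→ x)

  θ : Lin → Lin
  θ a = a ·L ((1# , Y) ∷ [])

module Submission where

-- θ grafts a leaf as the new rightmost child of the root: for a = a₀ ∨ ⋯ ∨ aₖ, a · Y = a₀ ∨ ⋯ ∨ aₖ ∨ |.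
-- That leaf hangs from the root, so no admissible cut moves it into a subtree: Δ̃←(a · Y) = 0, and the cuts
-- of a · Y are those of a with | grafted on the right of the root component, so Δ̃→(a · Y) is Δ̃(a) transported
-- along t ↦ t · Y. This gives well-definedness, and injectivity is clear. Conversely let b ∈ Prim_Codend(𝒜)ₙ₊₁.
-- Reading Δ̃←(b) = 0 at the pair (s, c₀ ∨ ⋯ ∨ cₖ ∨ |) shows, by induction on the number of leaves of s, that no
-- tree c₀ ∨ ⋯ ∨ cₖ ∨ s with s ≠ | occurs in b: only the cut of the last edge contributes, except for trees with
-- a smaller last subtree, and there the leaf count rules out any further cut. Reading Δ̃→(b) = 0 at (s, Y)
-- excludes s ∨ |. So b is a combination of trees a · Y with a ∈ Tₙ, and the correspondence between Δ̃ and Δ̃→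
-- makes this preimage primitive.

open import Defs
open import Level using (Level)
open import Algebra.Bundles using (Semiring)
open import Data.Bool using (Bool; true; false; if_then_else_; not; _∧_)
open import Data.Bool.Properties using (∧-zeroʳ)
open import Data.Empty using (⊥; ⊥-elim)
open import Data.List using (List; []; _∷_; _++_; _∷ʳ_; map; concatMap; length)
open import Data.List.Properties
  using (∷-injectiveˡ; ∷-injectiveʳ; ∷ʳ-injective; ++-assoc; ++-identityʳ; ++-conicalˡ; ++-conicalʳ; length-++)
open import Data.List.Relation.Unary.All using (All; []; _∷_; universal)
import Data.List.Relation.Unary.All as All
import Data.List.Relation.Unary.All.Properties as All
open import Data.Nat using (ℕ; suc; _≤_; _<_; z≤n; s≤s) renaming (_+_ to _+ℕ_)
import Data.Nat.Properties as ℕ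
open import Algebra.Properties.CommutativeSemigroup ℕ.+-commutativeSemigroup
  using () renaming (interchange to +-interchange)
open import Data.Product using (Σ; _×_; _,_; proj₁; proj₂)
open import Data.Sum using (_⊎_; inj₁; inj₂)
open import Relation.Nullary using (¬_; Dec; yes; no)
open import Relation.Nullary.Decidable using (⌊_⌋; isYes≗does; dec-true; dec-false)
open import Function using (_∘_)
import Relation.Binary.Reasoning.Setoid as SetoidReasoning
open import Relation.Binary.PropositionalEquality as ≡ using (_≡_; _≢_; refl; cong; cong₂; subst)

⌊⌋-yes : ∀ {p} {A : Set p} (d : Dec A) → A → ⌊ d ⌋ ≡ true
⌊⌋-yes d a = ≡.trans (isYes≗does d) (dec-true d a)

⌊⌋-no : ∀ {p} {A : Set p} (d : Dec A) → ¬ A → ⌊ d ⌋ ≡ false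
⌊⌋-no d ¬a = ≡.trans (isYes≗does d) (dec-false d ¬a)

⌊⌋-cong : ∀ {p q} {A : Set p} {B : Set q} (d : Dec A) (e : Dec B) → (A → B) → (B → A) → ⌊ d ⌋ ≡ ⌊ e ⌋
⌊⌋-cong d (yes b) f g = ⌊⌋-yes d (g b)
⌊⌋-cong d (no ¬b) f g = ⌊⌋-no d (λ a → ¬b (f a))

module FiniteSum {c ℓ} (R : Semiring c ℓ) where
  open Semiring R renaming (refl to ≈-refl; sym to ≈-sym; trans to ≈-trans)

  infixr 2 _⟫_
  _⟫_ : ∀ {x y z} → x ≈ y → y ≈ z → x ≈ z
  _⟫_ = ≈-trans

  sumBy : ∀ {a} {A : Set a} → (A → Carrier) → List A → Carrier
  sumBy h []       = 0#
  sumBy h (x ∷ xs) = h x + sumBy h xs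

  module _ {a} {A : Set a} where

    sumBy-++ : ∀ (h : A → Carrier) xs ys → sumBy h (xs ++ ys) ≈ sumBy h xs + sumBy h ys
    sumBy-++ h []       ys = ≈-sym (+-identityˡ _)
    sumBy-++ h (x ∷ xs) ys = +-cong ≈-refl (sumBy-++ h xs ys) ⟫ ≈-sym (+-assoc _ _ _)

    sumBy-cong : ∀ {h k : A → Carrier} → (∀ x → h x ≈ k x) → ∀ xs → sumBy h xs ≈ sumBy k xs
    sumBy-cong e []       = ≈-refl
    sumBy-cong e (x ∷ xs) = +-cong (e x) (sumBy-cong e xs)

    sumBy-map : ∀ {b} {B : Set b} (h : B → Carrier) (f : A → B) {k : A → Carrier} →
                (∀ x → h (f x) ≈ k x) → ∀ xs → sumBy h (map f xs) ≈ sumBy k xs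
    sumBy-map h f e []       = ≈-refl
    sumBy-map h f e (x ∷ xs) = +-cong (e x) (sumBy-map h f e xs)

    sumBy-All : ∀ {p} {P : A → Set p} {h : A → Carrier} →
                (∀ x → P x → h x ≈ 0#) → ∀ {xs} → All P xs → sumBy h xs ≈ 0#
    sumBy-All e []       = ≈-refl
    sumBy-All e (p ∷ ps) = +-cong (e _ p) (sumBy-All e ps) ⟫ +-identityˡ _

    sumBy-zero : ∀ {h : A → Carrier} → (∀ x → h x ≈ 0#) → ∀ xs → sumBy h xs ≈ 0#
    sumBy-zero e xs = sumBy-All (λ _ z → z) (universal e xs)

    sumBy-*ˡ : ∀ k (h : A → Carrier) xs → sumBy (λ x → k * h x) xs ≈ k * sumBy h xs
    sumBy-*ˡ k h []       = ≈-sym (zeroʳ k)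
    sumBy-*ˡ k h (x ∷ xs) = +-cong ≈-refl (sumBy-*ˡ k h xs) ⟫ ≈-sym (distribˡ k _ _)

  sumBy-concatMap : ∀ {a b} {A : Set a} {B : Set b} (h : B → Carrier) (f : A → List B) xs →
                    sumBy h (concatMap f xs) ≈ sumBy (λ x → sumBy h (f x)) xs
  sumBy-concatMap h f []       = ≈-refl
  sumBy-concatMap h f (x ∷ xs) = sumBy-++ h (f x) (concatMap f xs) ⟫ +-cong ≈-refl (sumBy-concatMap h f xs)

node-injective : ∀ {ts us} → node ts ≡ node us → ts ≡ us
node-injective refl = refl

node≢leaf : ∀ {ts} → node ts ≢ leaf
node≢leaf ()

Big : Tree → Set
Big t = 2 ≤ leaves t

leavesL-++ : ∀ xs ys → leavesL (xs ++ ys) ≡ leavesL xs +ℕ leavesL ys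
leavesL-++ [] ys = refl
leavesL-++ (x ∷ xs) ys rewrite leavesL-++ xs ys = ≡.sym (ℕ.+-assoc (leaves x) _ _)

leavesL-∷ʳ : ∀ xs w → leavesL (xs ∷ʳ w) ≡ leavesL xs +ℕ leaves w
leavesL-∷ʳ xs w rewrite leavesL-++ xs (w ∷ []) | ℕ.+-identityʳ (leaves w) = refl

Reduced⇒1≤leaves : ∀ {t} → Reduced t → 1 ≤ leaves t
Reduced⇒1≤leaves leaf-red = s≤s z≤n
Reduced⇒1≤leaves (node-red {t} (rt ∷ _)) = ℕ.≤-trans (Reduced⇒1≤leaves rt) (ℕ.m≤m+n (leaves t) _)

Reduced⇒Big : ∀ {ts} → Reduced (node ts) → Big (node ts)
Reduced⇒Big (node-red {t} {u} {ts} (rt ∷ ru ∷ _)) =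
  ℕ.≤-trans (ℕ.+-mono-≤ (Reduced⇒1≤leaves rt) (Reduced⇒1≤leaves ru))
            (ℕ.+-monoʳ-≤ (leaves t) (ℕ.m≤m+n (leaves u) (leavesL ts)))

Reduced-children : ∀ {ts} → Reduced (node ts) → All Reduced ts
Reduced-children (node-red rs) = rs

All-Big⇒ : ∀ {g} → All Big g → length g +ℕ length g ≤ leavesL g
All-Big⇒ [] = z≤n
All-Big⇒ {t ∷ g} (bt ∷ bg) rewrite ℕ.+-suc (length g) (length g) = ℕ.+-mono-≤ bt (All-Big⇒ bg)

≤-of-balance : ∀ {A C w u} → A +ℕ w ≡ C +ℕ u → u ≤ w → A ≤ C
≤-of-balance {A} {C} {w} e u≤w =
  ℕ.+-cancelʳ-≤ w A C (subst (_≤ C +ℕ w) (≡.sym e) (ℕ.+-monoʳ-≤ C u≤w))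

<-of-balance : ∀ {A C g G} → A +ℕ g ≡ C +ℕ G → g +ℕ g ≤ G → 1 ≤ g → C < A
<-of-balance {A} {C} {g} {G} e gg≤G 1≤g = ℕ.+-cancelʳ-≤ g (suc C) A (begin
    suc C +ℕ g      ≤⟨ ℕ.+-monoˡ-≤ g (subst (_≤ C +ℕ g) (ℕ.+-comm C 1) (ℕ.+-monoʳ-≤ C 1≤g)) ⟩
    C +ℕ g +ℕ g     ≡⟨ ℕ.+-assoc C g g ⟩
    C +ℕ (g +ℕ g)   ≤⟨ ℕ.+-monoʳ-≤ C gg≤G ⟩
    C +ℕ G          ≡⟨ ≡.sym e ⟩
    A +ℕ g          ∎)
  where open ℕ.≤-Reasoning

addLeaf : Tree → List Tree → Tree
addLeaf x xs = node ((x ∷ xs) ∷ʳ leaf)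

addLeaf-injective : ∀ {x xs y ys} → addLeaf x xs ≡ addLeaf y ys → node (x ∷ xs) ≡ node (y ∷ ys)
addLeaf-injective e = cong node (proj₁ (∷ʳ-injective _ _ (node-injective e)))

snocView : (xs : List Tree) → xs ≡ [] ⊎ Σ (List Tree) λ ys → Σ Tree λ w → xs ≡ ys ∷ʳ w
snocView [] = inj₁ refl
snocView (x ∷ xs) with snocView xs
... | inj₁ refl            = inj₂ ([] , x , refl)
... | inj₂ (ys , w , refl) = inj₂ (x ∷ ys , w , refl)

lastLeafView : (t : Tree) → (Σ (List Tree) λ q → t ≡ node (q ∷ʳ leaf)) ⊎ (∀ q → node (q ∷ʳ leaf) ≢ t)
lastLeafView leaf = inj₂ (λ q ())
lastLeafView (node xs) with snocView xs
... | inj₁ refl = inj₂ (λ q e → ∷ʳ≢[] q (node-injective e))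
  where ∷ʳ≢[] : ∀ q → q ∷ʳ leaf ≢ []
        ∷ʳ≢[] []      ()
        ∷ʳ≢[] (_ ∷ _) ()
... | inj₂ (ys , w , refl) with w ≟T leaf
...   | yes refl = inj₁ (ys , refl)
...   | no w≢leaf = inj₂ (λ q e → w≢leaf (≡.sym (proj₂ (∷ʳ-injective q ys (node-injective e)))))

lastChildView : ∀ {t} → Reduced t →
                t ≡ leaf ⊎ Σ Tree λ x → Σ (List Tree) λ zs → Σ Tree λ w → t ≡ node ((x ∷ zs) ∷ʳ w)
lastChildView leaf-red = inj₁ refl
lastChildView (node-red {x} {y} {ys} _) with snocView (y ∷ ys)
... | inj₂ (zs , w , e) = inj₂ (x , zs , w , cong (λ l → node (x ∷ l)) e)

addLeafView : (t : Tree) → (Σ Tree λ x → Σ (List Tree) λ xs → t ≡ addLeaf x xs) ⊎ (∀ x xs → addLeaf x xs ≢ t)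
addLeafView t with lastLeafView t
... | inj₁ ([] , refl)     = inj₂ (λ x xs e → noChildren (proj₁ (∷ʳ-injective (x ∷ xs) [] (node-injective e))))
  where noChildren : ∀ {x : Tree} {xs : List Tree} → x ∷ xs ≢ []
        noChildren ()
... | inj₁ (x ∷ xs , refl) = inj₁ (x , xs , refl)
... | inj₂ t≠              = inj₂ (λ x xs → t≠ (x ∷ xs))

dropLastLeaf : Tree → List Tree
dropLastLeaf t with addLeafView t
... | inj₁ (x , xs , _) = node (x ∷ xs) ∷ []
... | inj₂ _            = []

dropLastLeaf-addLeaf : ∀ x xs → dropLastLeaf (addLeaf x xs) ≡ node (x ∷ xs) ∷ []
dropLastLeaf-addLeaf x xs with addLeafView (addLeaf x xs)
... | inj₁ (y , ys , e) = cong (_∷ []) (≡.sym (addLeaf-injective e))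
... | inj₂ t≠           = ⊥-elim (t≠ x xs refl)

mutual
  reduced? : (t : Tree) → Dec (Reduced t)
  reduced? leaf = yes leaf-red
  reduced? (node []) = no λ ()
  reduced? (node (t ∷ [])) = no λ ()
  reduced? (node (t ∷ u ∷ ts)) with allReduced? (t ∷ u ∷ ts)
  ... | yes rs = yes (node-red rs)
  ... | no ¬rs = no λ { (node-red rs) → ¬rs rs }

  allReduced? : (ts : List Tree) → Dec (All Reduced ts)
  allReduced? [] = yes []
  allReduced? (t ∷ ts) with reduced? t | allReduced? ts
  ... | yes r | yes rs = yes (r ∷ rs)
  ... | no ¬r | _      = no λ { (r ∷ _) → ¬r r }
  ... | yes _ | no ¬rs = no λ { (_ ∷ rs) → ¬rs rs }

inT? : ∀ n t → Dec (InT n t)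
inT? n t with reduced? t | leaves t ℕ.≟ suc n
... | yes r | yes e = yes (r , e)
... | no ¬r | _     = no λ { (r , _) → ¬r r }
... | yes _ | no ¬e = no λ { (_ , e) → ¬e e }

leaf∉T[1+n] : ∀ {n} → ¬ InT (suc n) leaf
leaf∉T[1+n] (_ , ())

addLeaf-InT : ∀ {n x y ys} → InT n (node (x ∷ y ∷ ys)) → InT (suc n) (addLeaf x (y ∷ ys))
addLeaf-InT {n} {x} {y} {ys} (node-red rs , lv) = node-red (All.++⁺ rs (leaf-red ∷ [])) , lv′
  where lv′ : leavesL ((x ∷ y ∷ ys) ∷ʳ leaf) ≡ suc (suc n)
        lv′ rewrite leavesL-∷ʳ (x ∷ y ∷ ys) leaf | lv = ℕ.+-comm (suc n) 1

addLeaf-InT⁻¹ : ∀ {n x y ys} → InT (suc n) (addLeaf x (y ∷ ys)) → InT n (node (x ∷ y ∷ ys))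
addLeaf-InT⁻¹ {n} {x} {y} {ys} (red , lv) = node-red (All.++⁻ˡ (x ∷ y ∷ ys) (Reduced-children red)) , lv′
  where lv′ : leavesL (x ∷ y ∷ ys) ≡ suc n
        lv′ = ℕ.suc-injective (≡.trans (ℕ.+-comm 1 _) (≡.trans (≡.sym (leavesL-∷ʳ (x ∷ y ∷ ys) leaf)) lv))

-- Admissible cuts

ListOpt : Set
ListOpt = List Tree × List Tree × Bool

attach : Opt → ListOpt → ListOpt
attach (g , p , _) (gs , ps , b) = g ++ gs , p ∷ ps , b

extend : ListOpt → Opt → ListOpt
extend (g , p , _) (g′ , p′ , f′) = g ++ g′ , p ∷ʳ p′ , f′

-- Each cut edge becomes a leaf of the root component, whence the leaf balance.
record ChildCutInv (t : Tree) (g : List Tree) (p : Tree) : Set where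
  constructor childCutInv
  field
    uncut⇒whole : g ≡ [] → p ≡ t
    leafBalance : leaves t +ℕ length g ≡ leaves p +ℕ leavesL g
    subtreesBig : Reduced t → All Big g

record ListCutInv (ts g ps : List Tree) : Set where
  constructor listCutInv
  field
    uncut⇒whole : g ≡ [] → ps ≡ ts
    leafBalance : leavesL ts +ℕ length g ≡ leavesL ps +ℕ leavesL g
    subtreesBig : All Reduced ts → All Big g
    sameArity   : length ps ≡ length ts

ChildCutInvOpt : Tree → Opt → Set
ChildCutInvOpt t (g , p , _) = ChildCutInv t g p

ListCutInvOpt : List Tree → ListOpt → Set
ListCutInvOpt ts (g , ps , _) = ListCutInv ts g ps

attach-inv : ∀ t ts o r → ChildCutInvOpt t o → ListCutInvOpt ts r → ListCutInvOpt (t ∷ ts) (attach o r)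
attach-inv t ts (g , p , _) (gs , ps , _) (childCutInv w₁ b₁ s₁) (listCutInv w₂ b₂ s₂ a₂) = listCutInv
  (λ e → cong₂ _∷_ (w₁ (++-conicalˡ g gs e)) (w₂ (++-conicalʳ g gs e)))
  balance
  (λ { (rt ∷ rts) → All.++⁺ (s₁ rt) (s₂ rts) })
  (cong suc a₂)
  where
    balance : (leaves t +ℕ leavesL ts) +ℕ length (g ++ gs) ≡ (leaves p +ℕ leavesL ps) +ℕ leavesL (g ++ gs)
    balance rewrite length-++ g {gs} | leavesL-++ g gs
      | +-interchange (leaves t) (leavesL ts) (length g) (length gs) | b₁ | b₂ =
      +-interchange (leaves p) (leavesL g) (leavesL ps) (leavesL gs)

mutual
  cutsL-inv : ∀ ts → All (ListCutInvOpt ts) (cutsL ts)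
  cutsL-inv [] = listCutInv (λ _ → refl) refl (λ _ → []) refl ∷ []
  cutsL-inv (t ∷ []) = All.map⁺ (All.map (λ { {g , p , _} (childCutInv w b s) →
      listCutInv (λ e → cong (_∷ []) (w e)) (balance g p b) (λ { (rt ∷ []) → s rt }) refl }) (childOpts-inv t))
    where balance : ∀ g p → leaves t +ℕ length g ≡ leaves p +ℕ leavesL g →
                    (leaves t +ℕ 0) +ℕ length g ≡ (leaves p +ℕ 0) +ℕ leavesL g
          balance g p e rewrite ℕ.+-identityʳ (leaves t) | ℕ.+-identityʳ (leaves p) = e
  cutsL-inv (t ∷ ts@(_ ∷ _)) =
    All.concat⁺ (All.map⁺ (All.map (λ {o} io → All.map⁺ (All.map (λ {r} → attach-inv t ts o r io) (cutsL-inv ts)))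
                                    (childOpts-inv t)))

  childOpts-inv : ∀ t → All (ChildCutInvOpt t) (childOpts t)
  childOpts-inv leaf = childCutInv (λ _ → refl) refl (λ _ → []) ∷ []
  childOpts-inv (node ts) = childCutInv (λ ()) balance (λ r → Reduced⇒Big r ∷ []) ∷ cutsT-inv (node ts)
    where balance : leavesL ts +ℕ 1 ≡ 1 +ℕ (leavesL ts +ℕ 0)
          balance rewrite ℕ.+-identityʳ (leavesL ts) = ℕ.+-comm (leavesL ts) 1

  cutsT-inv : ∀ t → All (ChildCutInvOpt t) (cutsT t)
  cutsT-inv leaf = childCutInv (λ _ → refl) refl (λ _ → []) ∷ []
  cutsT-inv (node ts) = All.map⁺ (All.map (λ { {g , p , _} (listCutInv w b s _) →
    childCutInv (λ e → cong node (w e)) b (λ r → s (Reduced-children r)) }) (cutsL-inv ts))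

module SumsOverCuts {c ℓ} (R : Semiring c ℓ) where
  open Semiring R renaming (refl to ≈-refl; sym to ≈-sym)
  open FiniteSum R

  sumBy-combine : ∀ (h : ListOpt → Carrier) os rs →
                  sumBy h (combine os rs) ≈ sumBy (λ o → sumBy (λ r → h (attach o r)) rs) os
  sumBy-combine h [] rs = ≈-refl
  sumBy-combine h (o ∷ os) rs =
    sumBy-++ h (map _ rs) (combine os rs) ⟫
    +-cong (sumBy-map h _ (λ _ → ≈-refl) rs) (sumBy-combine h os rs)

  -- Only the empty cut leaves the whole tree in the root component.
  mutual
    sumBy-cutsL-emptyCut : ∀ ts (h : ListOpt → Carrier) → (∀ g p f → p ≢ ts → h (g , p , f) ≈ 0#) →
                           sumBy h (cutsL ts) ≈ h ([] , ts , false)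
    sumBy-cutsL-emptyCut [] h e = +-identityʳ _
    sumBy-cutsL-emptyCut (t ∷ []) h e =
      sumBy-map h single (λ _ → ≈-refl) (childOpts t) ⟫
      sumBy-childOpts-emptyCut t (λ o → h (single o)) (λ g p f p≢t → e g (p ∷ []) f (p≢t ∘ ∷-injectiveˡ))
    sumBy-cutsL-emptyCut (t ∷ ts@(_ ∷ _)) h e =
      sumBy-combine h (childOpts t) (cutsL ts) ⟫
      sumBy-cong (λ o@(g , p , f) → sumBy-cutsL-emptyCut ts (λ r → h (attach o r))
                                      (λ _ _ _ ne → e _ _ _ (ne ∘ ∷-injectiveʳ))) (childOpts t) ⟫
      sumBy-childOpts-emptyCut t (λ o → h (attach o ([] , ts , false))) (λ _ _ _ ne → e _ _ _ (ne ∘ ∷-injectiveˡ))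

    sumBy-childOpts-emptyCut : ∀ t (h : Opt → Carrier) → (∀ g p f → p ≢ t → h (g , p , f) ≈ 0#) →
                               sumBy h (childOpts t) ≈ h ([] , t , false)
    sumBy-childOpts-emptyCut leaf h e = +-identityʳ _
    sumBy-childOpts-emptyCut (node ts) h e =
      +-cong (e _ _ _ (λ ())) (sumBy-cutsT-emptyCut (node ts) h e) ⟫ +-identityˡ _

    sumBy-cutsT-emptyCut : ∀ t (h : Opt → Carrier) → (∀ g p f → p ≢ t → h (g , p , f) ≈ 0#) →
                           sumBy h (cutsT t) ≈ h ([] , t , false)
    sumBy-cutsT-emptyCut leaf h e = +-identityʳ _
    sumBy-cutsT-emptyCut (node ts) h e =
      sumBy-map h mkNode (λ _ → ≈-refl) (cutsL ts) ⟫
      sumBy-cutsL-emptyCut ts (λ o → h (mkNode o)) (λ g p f ne → e g (node p) f (ne ∘ node-injective))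

  sumBy-cutsL-∷ʳ : ∀ x xs y (h : ListOpt → Carrier) →
    sumBy h (cutsL ((x ∷ xs) ∷ʳ y)) ≈ sumBy (λ o → sumBy (λ o′ → h (extend o o′)) (childOpts y)) (cutsL (x ∷ xs))
  sumBy-cutsL-∷ʳ x [] y h =
    sumBy-combine h (childOpts x) (cutsL (y ∷ [])) ⟫
    sumBy-cong (λ _ → sumBy-map _ single (λ _ → ≈-refl) (childOpts y)) (childOpts x) ⟫
    ≈-sym (sumBy-map _ single (λ _ → ≈-refl) (childOpts x))
  sumBy-cutsL-∷ʳ x (z ∷ zs) y h =
    sumBy-combine h (childOpts x) (cutsL ((z ∷ zs) ∷ʳ y)) ⟫
    sumBy-cong (λ o → sumBy-cutsL-∷ʳ z zs y (λ r → h (attach o r))) (childOpts x) ⟫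
    sumBy-cong (λ (g , p , f) → sumBy-cong (λ (gs , ps , b) → sumBy-cong (λ (g′ , p′ , f′) →
        reflexive (cong (λ G → h (G , p ∷ (ps ∷ʳ p′) , f′)) (≡.sym (++-assoc g gs g′))))
      (childOpts y)) (cutsL (z ∷ zs))) (childOpts x) ⟫
    ≈-sym (sumBy-combine (λ o → sumBy (λ o′ → h (extend o o′)) (childOpts y)) (childOpts x) (cutsL (z ∷ zs)))


module _ {c ℓ : Level} (F : Field c ℓ) where
  open Field F renaming (refl to ≈-refl; sym to ≈-sym)
  open FiniteSum semiring
  open SetoidReasoning setoid

  open SumsOverCuts semiring

  δ : Tree → Tree → Carrier
  δ s t = if ⌊ s ≟T t ⌋ then 1# else 0#

  δ-refl : ∀ s → δ s s ≈ 1#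
  δ-refl s rewrite ⌊⌋-yes (s ≟T s) refl = ≈-refl

  δ-≢ : ∀ {s t} → s ≢ t → δ s t ≈ 0#
  δ-≢ {s} {t} s≢t rewrite ⌊⌋-no (s ≟T t) s≢t = ≈-refl

  δ-cong : ∀ {s t s′ t′} → (s ≡ t → s′ ≡ t′) → (s′ ≡ t′ → s ≡ t) → δ s t ≈ δ s′ t′
  δ-cong {s} {t} {s′} {t′} f g rewrite ⌊⌋-cong (s ≟T t) (s′ ≟T t′) f g = ≈-refl

  linExt : (Tree → Carrier) → Lin F → Carrier
  linExt G = sumBy (λ (a , s) → a * G s)

  coeff≈linExt-δ : ∀ t x → coeff F t x ≈ linExt (λ s → δ s t) x
  coeff≈linExt-δ t [] = ≈-refl
  coeff≈linExt-δ t ((a , s) ∷ x) with s ≟T t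
  ... | yes _ = +-cong (≈-sym (*-identityʳ a)) (coeff≈linExt-δ t x)
  ... | no _  = coeff≈linExt-δ t x ⟫ ≈-sym (+-identityˡ _) ⟫ +-cong (≈-sym (zeroʳ a)) ≈-refl

  linExt-cong : ∀ {G G′} → (∀ s → G s ≈ G′ s) → ∀ x → linExt G x ≈ linExt G′ x
  linExt-cong e = sumBy-cong (λ (a , s) → *-cong ≈-refl (e s))

  linExt-zero : ∀ {G} → (∀ s → G s ≈ 0#) → ∀ x → linExt G x ≈ 0#
  linExt-zero e = sumBy-zero (λ (a , s) → *-cong ≈-refl (e s) ⟫ zeroʳ a)

  linExt-scale : ∀ G k x → linExt G (scale F k x) ≈ k * linExt G x
  linExt-scale G k [] = ≈-sym (zeroʳ k)
  linExt-scale G k ((a , s) ∷ x) =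
    +-cong (*-assoc k a _) (linExt-scale G k x) ⟫ ≈-sym (distribˡ k _ _)

  linExt-single : ∀ G k s → linExt G ((k , s) ∷ []) ≈ k * G s
  linExt-single G k s = +-identityʳ _

  dropTerms : Tree → Lin F → Lin F
  dropTerms r [] = []
  dropTerms r ((a , s) ∷ x) with s ≟T r
  ... | yes _ = dropTerms r x
  ... | no _  = (a , s) ∷ dropTerms r x

  length-dropTerms : ∀ r x → length (dropTerms r x) ≤ length x
  length-dropTerms r [] = z≤n
  length-dropTerms r ((a , s) ∷ x) with s ≟T r
  ... | yes _ = ℕ.m≤n⇒m≤1+n (length-dropTerms r x)
  ... | no _  = s≤s (length-dropTerms r x)

  coeff-dropTerms-self : ∀ r x → coeff F r (dropTerms r x) ≈ 0#
  coeff-dropTerms-self r [] = ≈-refl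
  coeff-dropTerms-self r ((a , s) ∷ x) with s ≟T r
  ... | yes _ = coeff-dropTerms-self r x
  ... | no s≢r rewrite ⌊⌋-no (s ≟T r) s≢r = coeff-dropTerms-self r x

  coeff-dropTerms-≢ : ∀ {r t} x → t ≢ r → coeff F t (dropTerms r x) ≈ coeff F t x
  coeff-dropTerms-≢ [] _ = ≈-refl
  coeff-dropTerms-≢ {r} {t} ((a , s) ∷ x) t≢r with s ≟T r
  ... | yes refl rewrite ⌊⌋-no (s ≟T t) (λ s≡t → t≢r (≡.sym s≡t)) = coeff-dropTerms-≢ x t≢r
  ... | no _ with s ≟T t
  ...   | yes _ = +-cong ≈-refl (coeff-dropTerms-≢ x t≢r)
  ...   | no _  = coeff-dropTerms-≢ x t≢r

  linExt-dropTerms : ∀ G r x → linExt G x ≈ coeff F r x * G r + linExt G (dropTerms r x)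
  linExt-dropTerms G r [] = ≈-sym (+-identityʳ _ ⟫ zeroˡ _)
  linExt-dropTerms G r ((a , s) ∷ x) with s ≟T r
  ... | yes refl = begin
        a * G s + linExt G x                                        ≈⟨ +-cong ≈-refl (linExt-dropTerms G s x) ⟩
        a * G s + (coeff F s x * G s + linExt G (dropTerms s x))     ≈⟨ +-assoc _ _ _ ⟨
        (a * G s + coeff F s x * G s) + linExt G (dropTerms s x)     ≈⟨ +-cong (distribʳ _ _ _) ≈-refl ⟨
        (a + coeff F s x) * G s + linExt G (dropTerms s x)           ∎
  ... | no _ = begin
        a * G s + linExt G x                                        ≈⟨ +-cong ≈-refl (linExt-dropTerms G r x) ⟩
        a * G s + (coeff F r x * G r + linExt G (dropTerms r x))     ≈⟨ +-assoc _ _ _ ⟨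
        (a * G s + coeff F r x * G r) + linExt G (dropTerms r x)     ≈⟨ +-cong (+-comm _ _) ≈-refl ⟩
        (coeff F r x * G r + a * G s) + linExt G (dropTerms r x)     ≈⟨ +-assoc _ _ _ ⟩
        coeff F r x * G r + (a * G s + linExt G (dropTerms r x))     ∎

  -- Induction on the number of terms: the terms of the first tree are collected and then dropped.
  linExt-cong-on-support : ∀ G₁ G₂ x → (∀ r → coeff F r x ≈ 0# ⊎ G₁ r ≈ G₂ r) → linExt G₁ x ≈ linExt G₂ x
  linExt-cong-on-support G₁ G₂ x = go (length x) x ℕ.≤-refl
    where
      go : ∀ k x → length x ≤ k → (∀ r → coeff F r x ≈ 0# ⊎ G₁ r ≈ G₂ r) → linExt G₁ x ≈ linExt G₂ x
      go k [] _ _ = ≈-refl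
      go (suc k) x@((_ , s) ∷ x′) (s≤s len≤k) agree = begin
          linExt G₁ x                                   ≈⟨ linExt-dropTerms G₁ s x ⟩
          coeff F s x * G₁ s + linExt G₁ (dropTerms s x) ≈⟨ +-cong agreeAt-s (go k (dropTerms s x) len′≤k agree′) ⟩
          coeff F s x * G₂ s + linExt G₂ (dropTerms s x) ≈⟨ linExt-dropTerms G₂ s x ⟨
          linExt G₂ x                                   ∎
        where
          agreeAt-s : coeff F s x * G₁ s ≈ coeff F s x * G₂ s
          agreeAt-s with agree s
          ... | inj₁ z = *-cong z ≈-refl ⟫ zeroˡ _ ⟫ ≈-sym (*-cong z ≈-refl ⟫ zeroˡ _)
          ... | inj₂ e = *-cong ≈-refl e
          len′≤k : length (dropTerms s x) ≤ k
          len′≤k with s ≟T s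
          ... | yes _  = ℕ.≤-trans (length-dropTerms s x′) len≤k
          ... | no s≢s = ⊥-elim (s≢s refl)
          agree′ : ∀ r → coeff F r (dropTerms s x) ≈ 0# ⊎ G₁ r ≈ G₂ r
          agree′ r with r ≟T s | agree r
          ... | yes refl | _      = inj₁ (coeff-dropTerms-self r x)
          ... | no r≢s   | inj₁ z = inj₁ (coeff-dropTerms-≢ x r≢s ⟫ z)
          ... | no _     | inj₂ e = inj₂ e

  coeff2-++ : ∀ s t x y → coeff2 F s t (x ++ y) ≈ coeff2 F s t x + coeff2 F s t y
  coeff2-++ s t [] y = ≈-sym (+-identityˡ _)
  coeff2-++ s t ((a , u , v) ∷ x) y with ⌊ u ≟T s ⌋ ∧ ⌊ v ≟T t ⌋
  ... | true  = +-cong ≈-refl (coeff2-++ s t x y) ⟫ ≈-sym (+-assoc _ _ _)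
  ... | false = coeff2-++ s t x y

  coeff2-scale2 : ∀ s t k x → coeff2 F s t (scale2 F k x) ≈ k * coeff2 F s t x
  coeff2-scale2 s t k [] = ≈-sym (zeroʳ k)
  coeff2-scale2 s t k ((a , u , v) ∷ x) with ⌊ u ≟T s ⌋ ∧ ⌊ v ≟T t ⌋
  ... | true  = +-cong ≈-refl (coeff2-scale2 s t k x) ⟫ ≈-sym (distribˡ k _ _)
  ... | false = coeff2-scale2 s t k x

  coeff2-concatMap : ∀ {a} {A : Set a} s t (f : A → Lin2 F) xs →
                     coeff2 F s t (concatMap f xs) ≈ sumBy (λ x → coeff2 F s t (f x)) xs
  coeff2-concatMap s t f [] = ≈-refl
  coeff2-concatMap s t f (x ∷ xs) = coeff2-++ s t (f x) (concatMap f xs) ⟫ +-cong ≈-refl (coeff2-concatMap s t f xs)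

  -- The map is abstracted because the pattern lambda in deltaSel is not definitionally equal to any other.
  coeff2-⊗ : ∀ s t p (m : Carrier × Tree → Carrier × Tree × Tree) → (∀ a w → m (a , w) ≡ (a , w , p)) →
             ∀ X → coeff2 F s t (map m X) ≈ (if ⌊ p ≟T t ⌋ then coeff F s X else 0#)
  coeff2-⊗ s t p m e [] with ⌊ p ≟T t ⌋
  ... | true  = ≈-refl
  ... | false = ≈-refl
  coeff2-⊗ s t p m e ((a , w) ∷ X) rewrite e a w with p ≟T t | w ≟T s | coeff2-⊗ s t p m e X
  ... | yes _ | yes _ | ih = +-cong ≈-refl ih
  ... | yes _ | no _  | ih = ih
  ... | no _  | yes _ | ih = ih
  ... | no _  | no _  | ih = ih

  cutCoeff : (Bool → Bool) → Tree → Tree → Tree → Carrier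
  cutCoeff sel u t r = coeff2 F u t (deltaSel F sel r)

  coeff2-deltaSelL : ∀ sel u t x → coeff2 F u t (deltaSelL F sel x) ≈ linExt (cutCoeff sel u t) x
  coeff2-deltaSelL sel u t x =
    coeff2-concatMap u t _ x ⟫ sumBy-cong (λ (a , r) → coeff2-scale2 u t a (deltaSel F sel r)) x

  cutTerm : (Bool → Bool) → Tree → Tree → Opt → Carrier
  cutTerm sel u t (gs , p , b) =
    if isCons gs ∧ sel b then (if ⌊ p ≟T t ⌋ then coeff F u (prodG F gs) else 0#) else 0#

  cutCoeff≈sumBy-cutTerm : ∀ sel u t r → cutCoeff sel u t r ≈ sumBy (cutTerm sel u t) (cutsT r)
  cutCoeff≈sumBy-cutTerm sel u t r =
    coeff2-concatMap u t _ (cutsT r) ⟫ sumBy-cong (λ (gs , p , b) → term gs p b _ (λ _ _ → refl)) (cutsT r)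
    where
      term : ∀ gs p b (m : Carrier × Tree → Carrier × Tree × Tree) → (∀ a w → m (a , w) ≡ (a , w , p)) →
             coeff2 F u t (if isCons gs ∧ sel b then map m (prodG F gs) else []) ≈ cutTerm sel u t (gs , p , b)
      term gs p b m e with isCons gs ∧ sel b
      ... | true  = coeff2-⊗ u t p m e (prodG F gs)
      ... | false = ≈-refl

  cutTerm-unselected : ∀ {sel u t gs p b} → sel b ≡ false → cutTerm sel u t (gs , p , b) ≈ 0#
  cutTerm-unselected {gs = gs} e rewrite e | ∧-zeroʳ (isCons gs) = ≈-refl

  cutTerm-otherRoot : ∀ {sel u t gs p b} → p ≢ t → cutTerm sel u t (gs , p , b) ≈ 0#
  cutTerm-otherRoot {sel} {t = t} {gs} {p} {b} p≢t rewrite ⌊⌋-no (p ≟T t) p≢t with isCons gs ∧ sel b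
  ... | true  = ≈-refl
  ... | false = ≈-refl

  cutCoeff-leaf : ∀ sel u t → cutCoeff sel u t leaf ≈ 0#
  cutCoeff-leaf sel u t = cutCoeff≈sumBy-cutTerm sel u t leaf ⟫ +-identityʳ _

  cutCoeff-toLeaf : ∀ sel u r → cutCoeff sel u leaf r ≈ 0#
  cutCoeff-toLeaf sel u leaf      = cutCoeff-leaf sel u leaf
  cutCoeff-toLeaf sel u (node ws) =
    cutCoeff≈sumBy-cutTerm sel u leaf (node ws) ⟫
    sumBy-map _ mkNode {k = λ _ → 0#}
      (λ (g , ps , f) → cutTerm-otherRoot {sel} {u} {leaf} {g} {node ps} {f} node≢leaf) (cutsL ws) ⟫
    sumBy-zero (λ _ → ≈-refl) (cutsL ws)

  cutCoeff-node : ∀ sel u t ws → cutCoeff sel u t (node ws) ≈ sumBy (λ o → cutTerm sel u t (mkNode o)) (cutsL ws)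
  cutCoeff-node sel u t ws = cutCoeff≈sumBy-cutTerm sel u t (node ws) ⟫ sumBy-map _ mkNode (λ _ → ≈-refl) (cutsL ws)

  -- The last edge of an addLeaf tree is not internal, so its rightmost leaf always stays in the root component.
  cutCoeff-addLeaf : ∀ sel u t x xs → cutCoeff sel u t (addLeaf x xs) ≈
                     sumBy (λ (g , ps , _) → cutTerm sel u t (g ++ [] , node (ps ∷ʳ leaf) , false)) (cutsL (x ∷ xs))
  cutCoeff-addLeaf sel u t x xs =
    cutCoeff-node sel u t ((x ∷ xs) ∷ʳ leaf) ⟫ sumBy-cutsL-∷ʳ x xs leaf _ ⟫
    sumBy-cong (λ _ → +-identityʳ _) (cutsL (x ∷ xs))

  cutCoeff←-addLeaf : ∀ u t x xs → cutCoeff (λ b → b) u t (addLeaf x xs) ≈ 0#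
  cutCoeff←-addLeaf u t x xs =
    cutCoeff-addLeaf _ u t x xs ⟫
    sumBy-zero (λ (g , ps , _) → cutTerm-unselected {λ b → b} {u} {t} {g ++ []} {node (ps ∷ʳ leaf)} refl)
               (cutsL (x ∷ xs))

  cutCoeff→-addLeaf : ∀ u q x xs →
    cutCoeff not u (node (q ∷ʳ leaf)) (addLeaf x xs) ≈ cutCoeff (λ _ → true) u (node q) (node (x ∷ xs))
  cutCoeff→-addLeaf u q x xs =
    cutCoeff-addLeaf not u _ x xs ⟫ sumBy-cong (λ (g , p , f) → term g p f) (cutsL (x ∷ xs)) ⟫
    ≈-sym (cutCoeff-node (λ _ → true) u (node q) (x ∷ xs))
    where
      term : ∀ g p f → cutTerm not u (node (q ∷ʳ leaf)) (g ++ [] , node (p ∷ʳ leaf) , false) ≈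
                       cutTerm (λ _ → true) u (node q) (g , node p , f)
      term g p f rewrite ++-identityʳ g
        | ⌊⌋-cong (node (p ∷ʳ leaf) ≟T node (q ∷ʳ leaf)) (node p ≟T node q)
                  (cong node ∘ proj₁ ∘ ∷ʳ-injective p q ∘ node-injective)
                  (cong (λ r → node (r ∷ʳ leaf)) ∘ node-injective) = ≈-refl

  cutCoeff→-addLeaf-otherRoot : ∀ u t x xs → (∀ q → node (q ∷ʳ leaf) ≢ t) → cutCoeff not u t (addLeaf x xs) ≈ 0#
  cutCoeff→-addLeaf-otherRoot u t x xs t≠ =
    cutCoeff-addLeaf not u t x xs ⟫
    sumBy-zero (λ (g , p , _) → cutTerm-otherRoot {not} {u} {t} {g ++ []} {b = false} (t≠ p)) (cutsL (x ∷ xs))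

  coeff-prodG-single : ∀ w u → coeff F u (prodG F (w ∷ [])) ≈ δ w u
  coeff-prodG-single w u = begin
      coeff F u (prodG F (w ∷ []))            ≡⟨ cong (coeff F u) (prodG-single w) ⟩
      coeff F u ((1# * 1# * 1# , w) ∷ [])     ≈⟨ coeff≈linExt-δ u ((1# * 1# * 1# , w) ∷ []) ⟩
      linExt (λ s → δ s u) ((1# * 1# * 1# , w) ∷ []) ≈⟨ linExt-single (λ s → δ s u) _ w ⟩
      1# * 1# * 1# * δ w u                    ≈⟨ *-cong (*-identityʳ _ ⟫ *-identityʳ _) ≈-refl ⟩
      1# * δ w u                              ≈⟨ *-identityˡ _ ⟩
      δ w u                                   ∎
    where prodG-single : ∀ w → prodG F (w ∷ []) ≡ (1# * 1# * 1# , w) ∷ []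
          prodG-single leaf     = refl
          prodG-single (node _) = refl

  -- A root component ending in a leaf forces the last edge of a tree ending in a subtree to be cut.
  cutCoeff-lastChildNode : ∀ sel u q x xs vs →
    cutCoeff sel u (node (q ∷ʳ leaf)) (node ((x ∷ xs) ∷ʳ node vs)) ≈
    sumBy (λ (g , p , _) → cutTerm sel u (node (q ∷ʳ leaf)) (g ∷ʳ node vs , node (p ∷ʳ leaf) , true)) (cutsL (x ∷ xs))
  cutCoeff-lastChildNode sel u q x xs vs =
    cutCoeff-node sel u _ ((x ∷ xs) ∷ʳ node vs) ⟫
    sumBy-cutsL-∷ʳ x xs (node vs) (λ o → cutTerm sel u (node (q ∷ʳ leaf)) (mkNode o)) ⟫
    sumBy-cong (λ (g , p , f) → +-cong ≈-refl (uncutLast g p f) ⟫ +-identityʳ _) (cutsL (x ∷ xs))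
    where
      uncutLast : ∀ g p f → sumBy (λ o′ → cutTerm sel u (node (q ∷ʳ leaf)) (mkNode (extend (g , p , f) o′)))
                                  (cutsT (node vs)) ≈ 0#
      uncutLast g p f =
        sumBy-map _ mkNode {k = λ _ → 0#} (λ (g′ , ps′ , f′) → cutTerm-otherRoot {sel} {u} {_} {g ++ g′} {b = f′}
          (λ e → node≢leaf (proj₂ (∷ʳ-injective p q (node-injective e))))) (cutsL vs) ⟫
        sumBy-zero (λ _ → ≈-refl) (cutsL vs)

  cutCoeff→-lastChildNode : ∀ u q x xs vs → cutCoeff not u (node (q ∷ʳ leaf)) (node ((x ∷ xs) ∷ʳ node vs)) ≈ 0#
  cutCoeff→-lastChildNode u q x xs vs =
    cutCoeff-lastChildNode not u q x xs vs ⟫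
    sumBy-zero (λ (g , p , _) → cutTerm-unselected {not} {u} {_} {g ∷ʳ node vs} {node (p ∷ʳ leaf)} refl)
               (cutsL (x ∷ xs))

  cutCoeff-Y-arity : ∀ sel u ts → length ts ≢ 2 → cutCoeff sel u Y (node ts) ≈ 0#
  cutCoeff-Y-arity sel u ts arity≢2 =
    cutCoeff-node sel u Y ts ⟫ sumBy-All (λ (g , ps , f) inv → cutTerm-otherRoot {sel} {u} {Y} {g} {b = f}
      (λ e → arity≢2 (≡.trans (≡.sym (ListCutInv.sameArity inv)) (cong length (node-injective e))))) (cutsL-inv ts)

  cutCoeff→-Y : ∀ ws r → cutCoeff not (node ws) Y r ≈ δ r (node (node ws ∷ leaf ∷ []))
  cutCoeff→-Y ws leaf = cutCoeff-leaf not (node ws) Y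
  cutCoeff→-Y ws (node [])                      = cutCoeff-Y-arity not (node ws) [] (λ ())
  cutCoeff→-Y ws (node (x ∷ []))                = cutCoeff-Y-arity not (node ws) (x ∷ []) (λ ()) ⟫ ≈-sym (δ-≢ (λ ()))
  cutCoeff→-Y ws (node (x ∷ y ∷ z ∷ zs))        =
    cutCoeff-Y-arity not (node ws) (x ∷ y ∷ z ∷ zs) (λ ()) ⟫ ≈-sym (δ-≢ (λ ()))
  cutCoeff→-Y ws (node (x ∷ node vs ∷ []))      =
    cutCoeff→-lastChildNode (node ws) (leaf ∷ []) x [] vs ⟫
    ≈-sym (δ-≢ (node≢leaf ∘ ∷-injectiveˡ ∘ ∷-injectiveʳ ∘ node-injective))
  cutCoeff→-Y ws (node (leaf ∷ leaf ∷ []))      = cutCoeff-node not (node ws) Y (leaf ∷ leaf ∷ []) ⟫ +-identityʳ _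
  cutCoeff→-Y ws (node (node ts ∷ leaf ∷ []))   =
    cutCoeff→-addLeaf (node ws) (leaf ∷ []) (node ts) [] ⟫ cutCoeff-node full (node ws) root (node ts ∷ []) ⟫
    +-cong (coeff-prodG-single (node ts) (node ws)) uncut ⟫ +-identityʳ _ ⟫
    δ-cong (cong (λ t → node (t ∷ leaf ∷ []))) (∷-injectiveˡ ∘ node-injective)
    where
      full : Bool → Bool
      full _ = true
      root : Tree
      root = node (leaf ∷ [])
      uncut : sumBy (λ o → cutTerm full (node ws) root (mkNode o)) (map single (cutsT (node ts))) ≈ 0#
      uncut =
        sumBy-map _ single {k = λ o → cutTerm full (node ws) root (mkNode (single o))} (λ _ → ≈-refl)
                  (cutsT (node ts)) ⟫
        sumBy-map _ mkNode {k = λ _ → 0#}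
          (λ (g , ps , f) → cutTerm-otherRoot {full} {node ws} {root} {g} {node (node ps ∷ [])} {f}
                              (λ e → node≢leaf (∷-injectiveˡ (node-injective e))))
          (cutsL ts) ⟫
        sumBy-zero (λ _ → ≈-refl) (cutsL ts)

  -- If the last subtree is not smaller than ws, cutting anything off the other children loses too many leaves.
  cutCoeff←-lastChildNode : ∀ cs ws x zs vs →
    Reduced (node ((x ∷ zs) ∷ʳ node vs)) → leavesL ((x ∷ zs) ∷ʳ node vs) ≡ leavesL (cs ∷ʳ node ws) →
    leaves (node ws) ≤ leaves (node vs) →
    cutCoeff (λ b → b) (node ws) (node (cs ∷ʳ leaf)) (node ((x ∷ zs) ∷ʳ node vs)) ≈
    δ (node ((x ∷ zs) ∷ʳ node vs)) (node (cs ∷ʳ node ws))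
  cutCoeff←-lastChildNode cs ws x zs vs red sameLeaves ws≤vs =
    cutCoeff-lastChildNode (λ b → b) (node ws) cs x zs vs ⟫ cutLast
    where
      term : ListOpt → Carrier
      term (g , p , _) = cutTerm (λ b → b) (node ws) (node (cs ∷ʳ leaf)) (g ∷ʳ node vs , node (p ∷ʳ leaf) , true)

      isCons-∷ʳ : ∀ g w → isCons (g ∷ʳ w) ≡ true
      isCons-∷ʳ []      w = refl
      isCons-∷ʳ (_ ∷ _) w = refl

      term-otherRoot : ∀ g p f → p ≢ cs → term (g , p , f) ≈ 0#
      term-otherRoot g p f p≢cs = cutTerm-otherRoot {λ b → b} {gs = g ∷ʳ node vs} {b = true}
        (λ e → p≢cs (proj₁ (∷ʳ-injective p cs (node-injective e))))

      term-root : ∀ g f → term (g , cs , f) ≈ coeff F (node ws) (prodG F (g ∷ʳ node vs))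
      term-root g f rewrite isCons-∷ʳ g (node vs) | ⌊⌋-yes (node (cs ∷ʳ leaf) ≟T node (cs ∷ʳ leaf)) refl = ≈-refl

      cutsLeft⇒⊥ : ∀ {g₀ gs} → ListCutInv (x ∷ zs) (g₀ ∷ gs) cs → ⊥
      cutsLeft⇒⊥ {g₀} {gs} (listCutInv _ balance big _) = ℕ.<⇒≱ fewerLeft moreLeft
        where
          fewerLeft : leavesL cs < leavesL (x ∷ zs)
          fewerLeft = <-of-balance balance (All-Big⇒ (big (All.++⁻ˡ (x ∷ zs) (Reduced-children red)))) (s≤s z≤n)
          moreLeft : leavesL (x ∷ zs) ≤ leavesL cs
          moreLeft = ≤-of-balance (≡.trans (≡.sym (leavesL-∷ʳ (x ∷ zs) (node vs)))
                                   (≡.trans sameLeaves (leavesL-∷ʳ cs (node ws)))) ws≤vs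

      cutLast : sumBy term (cutsL (x ∷ zs)) ≈ δ (node ((x ∷ zs) ∷ʳ node vs)) (node (cs ∷ʳ node ws))
      cutLast with node ((x ∷ zs) ∷ʳ node vs) ≟T node (cs ∷ʳ node ws)
      ... | yes e with ∷ʳ-injective (x ∷ zs) cs (node-injective e)
      ...   | refl , refl =
        sumBy-cutsL-emptyCut (x ∷ zs) term term-otherRoot ⟫ term-root [] false ⟫
        coeff-prodG-single (node ws) (node ws) ⟫ δ-refl (node ws)
      cutLast | no r≢target = sumBy-All termVanishes (cutsL-inv (x ∷ zs))
        where
          termVanishes : ∀ o → ListCutInvOpt (x ∷ zs) o → term o ≈ 0#
          termVanishes (g , p , f) inv with p ≟L cs
          ... | no p≢cs = term-otherRoot g p f p≢cs
          ... | yes refl with g | inv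
          ...   | g₀ ∷ gs | inv′ = ⊥-elim (cutsLeft⇒⊥ inv′)
          ...   | []      | listCutInv whole _ _ _ =
            term-root [] f ⟫ coeff-prodG-single (node vs) (node ws) ⟫
            δ-≢ (λ vs≡ws → r≢target (cong₂ (λ l w → node (l ∷ʳ w)) (≡.sym (whole refl)) vs≡ws))

  -- The map θ

  lastStar-leaf : ∀ x xs → lastStar F (x ∷ xs) leaf ≡ (1# , x ∷ xs) ∷ []
  lastStar-leaf leaf     [] = refl
  lastStar-leaf (node _) [] = refl
  lastStar-leaf x (y ∷ ys) rewrite lastStar-leaf y ys = refl

  linExt-·Y : ∀ G x xs → linExt G (_·T_ F (node (x ∷ xs)) Y) ≈ G (addLeaf x xs)
  linExt-·Y G x xs rewrite lastStar-leaf x xs = linExt-single G 1# _ ⟫ *-identityˡ _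

  linExt-θ : ∀ G a → linExt G (θ F a) ≈ linExt (λ s → linExt G (_·T_ F s Y)) a
  linExt-θ G a = sumBy-concatMap _ _ a ⟫ sumBy-cong term a
    where
      term : ∀ ((a , s) : Carrier × Tree) →
             linExt G (scale F (a * 1#) (_·T_ F s Y) ++ []) ≈ a * linExt G (_·T_ F s Y)
      term (a , s) = begin
        linExt G (scale F (a * 1#) sY ++ [])  ≡⟨ cong (linExt G) (++-identityʳ (scale F (a * 1#) sY)) ⟩
        linExt G (scale F (a * 1#) sY)        ≈⟨ linExt-scale G _ sY ⟩
        (a * 1#) * linExt G sY                ≈⟨ *-cong (*-identityʳ a) ≈-refl ⟩
        a * linExt G sY                       ∎
        where sY = _·T_ F s Y

  linExt-·Y≈ : ∀ (G H : Tree → Carrier) → H leaf ≈ 0# → H (node []) ≈ 0# →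
               (∀ x xs → G (addLeaf x xs) ≈ H (node (x ∷ xs))) →
               ∀ s → linExt G (_·T_ F s Y) ≈ H s
  linExt-·Y≈ G H H-leaf H-node[] e leaf            = ≈-sym H-leaf
  linExt-·Y≈ G H H-leaf H-node[] e (node [])       = ≈-sym H-node[]
  linExt-·Y≈ G H H-leaf H-node[] e (node (x ∷ xs)) = linExt-·Y G x xs ⟫ e x xs

  coeff-θ-addLeaf : ∀ x xs a → coeff F (addLeaf x xs) (θ F a) ≈ coeff F (node (x ∷ xs)) a
  coeff-θ-addLeaf x xs a =
    coeff≈linExt-δ _ (θ F a) ⟫ linExt-θ _ a ⟫
    linExt-cong (linExt-·Y≈ _ (λ s → δ s (node (x ∷ xs))) ≈-refl ≈-refl
                  (λ z zs → δ-cong addLeaf-injective (cong (λ w → node (w ∷ʳ leaf)) ∘ node-injective))) a ⟫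
    ≈-sym (coeff≈linExt-δ _ a)

  θ-InA : ∀ n a → InA F n a → InA F (suc n) (θ F a)
  θ-InA n a a∈Aₙ t t∉Tₙ₊₁ =
    coeff≈linExt-δ t (θ F a) ⟫ linExt-θ _ a ⟫
    linExt-cong-on-support _ (λ _ → 0#) a onSupport ⟫ linExt-zero (λ _ → ≈-refl) a
    where
      onSupport : ∀ s → coeff F s a ≈ 0# ⊎ linExt (λ s′ → δ s′ t) (_·T_ F s Y) ≈ 0#
      onSupport s with inT? n s
      ... | no s∉Tₙ = inj₁ (a∈Aₙ s s∉Tₙ)
      ... | yes (leaf-red , _) = inj₂ ≈-refl
      ... | yes s∈Tₙ@(node-red {x} {y} {ys} _ , _) =
        inj₂ (linExt-·Y _ x (y ∷ ys) ⟫ δ-≢ (λ e → t∉Tₙ₊₁ (subst (InT (suc n)) e (addLeaf-InT s∈Tₙ))))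

  θ-Δ̃←≈0 : ∀ a → IsZero2 F (Δ̃← F (θ F a))
  θ-Δ̃←≈0 a u t =
    coeff2-deltaSelL _ u t (θ F a) ⟫ linExt-θ _ a ⟫
    linExt-zero (linExt-·Y≈ _ (λ _ → 0#) ≈-refl ≈-refl (cutCoeff←-addLeaf u t)) a

  θ-Δ̃→≈0 : ∀ a → IsZero2 F (Δ̃ F a) → IsZero2 F (Δ̃→ F (θ F a))
  θ-Δ̃→≈0 a Δa≈0 u t with lastLeafView t
  ... | inj₁ (q , refl) =
    coeff2-deltaSelL _ u _ (θ F a) ⟫ linExt-θ _ a ⟫
    linExt-cong (linExt-·Y≈ _ (cutCoeff (λ _ → true) u (node q)) (cutCoeff-leaf (λ _ → true) u (node q))
                  (cutCoeff-node (λ _ → true) u (node q) [] ⟫ +-identityʳ _) (cutCoeff→-addLeaf u q)) a ⟫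
    ≈-sym (coeff2-deltaSelL _ u (node q) a) ⟫ Δa≈0 u (node q)
  ... | inj₂ t≠ =
    coeff2-deltaSelL _ u t (θ F a) ⟫ linExt-θ _ a ⟫
    linExt-zero (linExt-·Y≈ _ (λ _ → 0#) ≈-refl ≈-refl (λ x xs → cutCoeff→-addLeaf-otherRoot u t x xs t≠)) a

  θ-injective : ∀ n → 1 ≤ n → ∀ a b → InA F n a → InA F n b → _≈L_ F (θ F a) (θ F b) → _≈L_ F a b
  θ-injective (suc n) (s≤s z≤n) a b a∈Aₙ b∈Aₙ θa≈θb t with inT? (suc n) t
  ... | no t∉Tₙ = a∈Aₙ t t∉Tₙ ⟫ ≈-sym (b∈Aₙ t t∉Tₙ)
  ... | yes (leaf-red , ())
  ... | yes (node-red {x} {y} {ys} _ , _) =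
    ≈-sym (coeff-θ-addLeaf x (y ∷ ys) a) ⟫ θa≈θb _ ⟫ coeff-θ-addLeaf x (y ∷ ys) b

  -- Surjectivity

  preimage : Lin F → Lin F
  preimage = concatMap (λ (c , t) → map (c ,_) (dropLastLeaf t))

  linExt-preimage : ∀ G H x → (∀ t → coeff F t x ≈ 0# ⊎ Σ Tree λ y → Σ (List Tree) λ ys → t ≡ addLeaf y ys) →
                    (∀ y ys → G (node (y ∷ ys)) ≈ H (addLeaf y ys)) → linExt G (preimage x) ≈ linExt H x
  linExt-preimage G H x support G≈H =
    sumBy-concatMap _ _ x ⟫
    sumBy-cong (λ (c , t) → sumBy-map _ (c ,_) (λ _ → ≈-refl) (dropLastLeaf t) ⟫ sumBy-*ˡ c G (dropLastLeaf t)) x ⟫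
    linExt-cong-on-support (λ t → sumBy G (dropLastLeaf t)) H x onSupport
    where
      onSupport : ∀ t → coeff F t x ≈ 0# ⊎ sumBy G (dropLastLeaf t) ≈ H t
      onSupport t with support t
      ... | inj₁ z = inj₁ z
      ... | inj₂ (y , ys , refl) rewrite dropLastLeaf-addLeaf y ys = inj₂ (+-identityʳ _ ⟫ G≈H y ys)

  module Surjectivity (n : ℕ) (1≤n : 1 ≤ n) (b : Lin F) (b∈Aₙ₊₁ : InA F (suc n) b)
                      (Δ←b≈0 : IsZero2 F (Δ̃← F b)) (Δ→b≈0 : IsZero2 F (Δ̃→ F b)) where

    coeff-lastChildNode≈0 : ∀ k cs ws → leaves (node ws) < k → coeff F (node (cs ∷ʳ node ws)) b ≈ 0#
    coeff-lastChildNode≈0 (suc k) cs ws ws<1+k with inT? (suc n) (node (cs ∷ʳ node ws))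
    ... | no t∉ = b∈Aₙ₊₁ _ t∉
    ... | yes (_ , lvt) =
      coeff≈linExt-δ _ b ⟫
      ≈-sym (linExt-cong-on-support (cutCoeff (λ b → b) (node ws) (node (cs ∷ʳ leaf))) _ b onSupport) ⟫
      ≈-sym (coeff2-deltaSelL _ (node ws) _ b) ⟫ Δ←b≈0 (node ws) (node (cs ∷ʳ leaf))
      where
        onSupport : ∀ r → coeff F r b ≈ 0# ⊎
                          cutCoeff (λ b → b) (node ws) (node (cs ∷ʳ leaf)) r ≈ δ r (node (cs ∷ʳ node ws))
        onSupport r with inT? (suc n) r
        ... | no r∉ = inj₁ (b∈Aₙ₊₁ r r∉)
        ... | yes (red , lvr) with lastChildView red
        ...   | inj₁ refl = ⊥-elim (leaf∉T[1+n] (red , lvr))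
        ...   | inj₂ (x , zs , leaf , refl) =
          inj₂ (cutCoeff←-addLeaf _ _ x zs ⟫
                ≈-sym (δ-≢ (λ e → node≢leaf (≡.sym (proj₂ (∷ʳ-injective (x ∷ zs) cs (node-injective e)))))))
        ...   | inj₂ (x , zs , node vs , refl) with leaves (node vs) ℕ.<? leaves (node ws)
        ...     | yes vs<ws = inj₁ (coeff-lastChildNode≈0 k (x ∷ zs) vs (ℕ.<-≤-trans vs<ws (ℕ.≤-pred ws<1+k)))
        ...     | no vs≮ws = inj₂ (cutCoeff←-lastChildNode cs ws x zs vs red (≡.trans lvr (≡.sym lvt)) (ℕ.≮⇒≥ vs≮ws))

    coeff-node-leaf≈0 : ∀ ws → coeff F (node (node ws ∷ leaf ∷ [])) b ≈ 0#
    coeff-node-leaf≈0 ws =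
      coeff≈linExt-δ _ b ⟫ linExt-cong (λ r → ≈-sym (cutCoeff→-Y ws r)) b ⟫
      ≈-sym (coeff2-deltaSelL not (node ws) Y b) ⟫ Δ→b≈0 (node ws) Y

    supportedOnAddLeaf : ∀ t → coeff F t b ≈ 0# ⊎ Σ Tree λ x → Σ (List Tree) λ xs → t ≡ addLeaf x xs
    supportedOnAddLeaf t with addLeafView t
    ... | inj₁ t≡addLeaf = inj₂ t≡addLeaf
    ... | inj₂ t≠ with inT? (suc n) t
    ...   | no t∉ = inj₁ (b∈Aₙ₊₁ t t∉)
    ...   | yes (red , lv) with lastChildView red
    ...     | inj₁ refl = ⊥-elim (leaf∉T[1+n] (red , lv))
    ...     | inj₂ (x , zs , leaf , refl) = ⊥-elim (t≠ x zs refl)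
    ...     | inj₂ (x , zs , node vs , refl) = inj₁ (coeff-lastChildNode≈0 _ (x ∷ zs) vs (ℕ.n<1+n _))

    coeff-preimage : ∀ x xs → coeff F (node (x ∷ xs)) (preimage b) ≈ coeff F (addLeaf x xs) b
    coeff-preimage x xs =
      coeff≈linExt-δ _ (preimage b) ⟫
      linExt-preimage _ (λ t → δ t (addLeaf x xs)) b supportedOnAddLeaf
        (λ y ys → δ-cong (cong (λ l → node (l ∷ʳ leaf)) ∘ node-injective) addLeaf-injective) ⟫
      ≈-sym (coeff≈linExt-δ _ b)

    coeff-preimage-other : ∀ t → (∀ x xs → node (x ∷ xs) ≢ t) → coeff F t (preimage b) ≈ 0#
    coeff-preimage-other t t≠ =
      coeff≈linExt-δ _ (preimage b) ⟫
      linExt-preimage _ (λ _ → 0#) b supportedOnAddLeaf (λ y ys → δ-≢ (t≠ y ys)) ⟫ linExt-zero (λ _ → ≈-refl) b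

    preimage∈Aₙ : InA F n (preimage b)
    preimage∈Aₙ leaf _ = coeff-preimage-other leaf (λ _ _ ())
    preimage∈Aₙ (node []) _ = coeff-preimage-other (node []) (λ _ _ ())
    preimage∈Aₙ (node (x ∷ xs)) t∉Tₙ with inT? (suc n) (addLeaf x xs)
    ... | no t∉ = coeff-preimage x xs ⟫ b∈Aₙ₊₁ _ t∉
    preimage∈Aₙ (node (leaf ∷ [])) _ | yes (_ , lv) =
      ⊥-elim (ℕ.<⇒≢ 1≤n (ℕ.suc-injective (ℕ.suc-injective lv)))
    preimage∈Aₙ (node (node ws ∷ [])) _ | yes _ = coeff-preimage (node ws) [] ⟫ coeff-node-leaf≈0 ws
    preimage∈Aₙ (node (x ∷ y ∷ ys)) t∉Tₙ | yes t∈ = ⊥-elim (t∉Tₙ (addLeaf-InT⁻¹ t∈))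

    θ-preimage : _≈L_ F (θ F (preimage b)) b
    θ-preimage t =
      coeff≈linExt-δ t (θ F (preimage b)) ⟫ linExt-θ _ (preimage b) ⟫
      linExt-preimage _ (λ s → δ s t) b supportedOnAddLeaf (λ y ys → linExt-·Y _ y ys) ⟫ ≈-sym (coeff≈linExt-δ t b)

    preimage-Δ̃≈0 : IsZero2 F (Δ̃ F (preimage b))
    preimage-Δ̃≈0 u leaf =
      coeff2-deltaSelL _ u leaf (preimage b) ⟫ linExt-zero (cutCoeff-toLeaf _ u) (preimage b)
    preimage-Δ̃≈0 u (node qs) =
      coeff2-deltaSelL _ u (node qs) (preimage b) ⟫
      linExt-preimage _ (cutCoeff not u (node (qs ∷ʳ leaf))) b supportedOnAddLeaf
        (λ y ys → ≈-sym (cutCoeff→-addLeaf u qs y ys)) ⟫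
      ≈-sym (coeff2-deltaSelL not u _ b) ⟫ Δ→b≈0 u (node (qs ∷ʳ leaf))

mainTheorem17 : ∀ {c ℓ : Level} (F : Field c ℓ) (n : ℕ) → 1 ≤ n →
    (∀ a → PrimCoass F n a → PrimCodend F (suc n) (θ F a))
    × (∀ a b → PrimCoass F n a → PrimCoass F n b → _≈L_ F (θ F a) (θ F b) → _≈L_ F a b)
    × (∀ b → PrimCodend F (suc n) b → Σ (Lin F) (λ a → PrimCoass F n a × _≈L_ F (θ F a) b))
mainTheorem17 F n 1≤n = wellDefined , injective , surjective
  where
    wellDefined : ∀ a → PrimCoass F n a → PrimCodend F (suc n) (θ F a)
    wellDefined a (a∈Aₙ , Δa≈0) = θ-InA F n a a∈Aₙ , θ-Δ̃←≈0 F a , θ-Δ̃→≈0 F a Δa≈0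

    injective : ∀ a b → PrimCoass F n a → PrimCoass F n b → _≈L_ F (θ F a) (θ F b) → _≈L_ F a b
    injective a b (a∈Aₙ , _) (b∈Aₙ , _) = θ-injective F n 1≤n a b a∈Aₙ b∈Aₙ

    surjective : ∀ b → PrimCodend F (suc n) b → Σ (Lin F) (λ a → PrimCoass F n a × _≈L_ F (θ F a) b)
    surjective b (b∈Aₙ₊₁ , Δ←b≈0 , Δ→b≈0) = preimage F b , (preimage∈Aₙ , preimage-Δ̃≈0) , θ-preimage
      where open Surjectivity F n 1≤n b b∈Aₙ₊₁ Δ←b≈0 Δ→b≈0
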